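{- Let $A$ be an induced subgraph of a digraph $X$ and suppose $X$ admits a projecting decomposition $\pi$ with respect to $A$. Let $x\to y$ be an edge of $X$ with both $x$ and $y$ admitting paths to $A$ and $h(x)\ge h(y)$. Then one of the following holds: (1) $h(x)=h(y)$ and there is an edge $\pi x\to\pi y$; (2) $h(x)=h(y)+1$ and $\pi x=\pi y$.
   Context: A digraph $X$ is a set $X_V$ with a reflexive binary relation ($x\to y$ an edge; in particular $v\to v$ for every vertex). Induced subgraph $A\subseteq X$: for $a,b\in A_V$, $a\to b$ in $A$ iff in $X$. A path of length $n$ from $x$ to $y$: $x=v_0\to v_1\to\dots\to v_n=y$. $X^A$: induced subgraph on vertices admitting a path to some vertex of $A$; the height $h(x)$ of $x\in X^A_V$ is the minimal length of a path from $x$ to a vertex of $A$. A projecting decomposition of $X$ w.r.t. $A$ is $\pi\colon X^A_V\to A_V$ such that for any $x\in X_V$ and $a\in A_V$ admitting a path from $x$, some minimal-length path from $x$ to $a$ passes through $\pi x$. -}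

module Defs where

open import Data.Nat using (ℕ; zero; suc; _≤_)
open import Data.Product using (Σ; ∃; ∃-syntax; _×_; _,_; proj₁)
open import Relation.Binary.PropositionalEquality using (_≡_)
open import Data.Sum using (_⊎_)

record Digraph : Set₁ where
  field
    V     : Set
    _⇒_   : V → V → Set
    ⇒-refl : ∀ v → v ⇒ v

module _ (X : Digraph) where
  open Digraph X

  data Path : V → V → ℕ → Set where
    [] : ∀ {x} → Path x x 0
    _∷_ : ∀ {x y z n} → x ⇒ y → Path y z n → Path x z (suc n)

  data PassesThrough : ∀ {x y n} → Path x y n → V → Set where
    start : ∀ {x y z n} {e : x ⇒ y} {p : Path y z n} → PassesThrough (e ∷ p) x
    end   : ∀ {x} → PassesThrough ([] {x}) x
    later : ∀ {x y z n v} {e : x ⇒ y} {p : Path y z n} →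
            PassesThrough p v → PassesThrough (e ∷ p) v

  MinimalPath : ∀ {x y n} → Path x y n → Set
  MinimalPath {x} {y} {n} _ = ∀ m → Path x y m → n ≤ m

module _ (X : Digraph) (A : Digraph.V X → Set) where
  -- The induced subgraph A is determined by its vertex set, given as a predicate.
  open Digraph X

  ReachesA : V → Set
  ReachesA x = ∃[ a ] ∃[ n ] (A a × Path X x a n)

  XA-V : Set
  XA-V = Σ V ReachesA

  A-V : Set
  A-V = Σ V A

  IsHeight : V → ℕ → Set
  IsHeight x n = (∃[ a ] (A a × Path X x a n))
               × (∀ a m → A a → Path X x a m → n ≤ m)

  IsProjectingDecomposition : (XA-V → A-V) → Set
  IsProjectingDecomposition π =
    ∀ (x : V) (r : ReachesA x) (a : V) → A a → (∃[ n ] Path X x a n) →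
      ∃[ n ] Σ (Path X x a n) λ p →
        MinimalPath X p × PassesThrough X p (proj₁ (π (x , r)))

{-# OPTIONS --safe #-}
module Submission where

-- A shortest path from y to A passes through πy, so πy is within h(y) of y. Prefixing the edge x → y
-- gives a path of length ≤ h(y) + 1 from x to πy, and a minimal such path passes through πx, hence
-- h(x) + d(πx, πy) ≤ h(y) + 1. Given h(x) ≥ h(y), either h(x) = h(y) and d(πx, πy) ≤ 1, which is an
-- edge since edges are reflexive, or h(x) = h(y) + 1 and πx = πy.

open import Defs
open import Data.Nat using (ℕ; zero; suc; _≥_; _+_; _≤_; _≰_; z≤n; s≤s; s≤s⁻¹)
open import Data.Nat.Properties
  using (≤-refl; ≤-trans; ≤-antisym; m≤n⇒m<n∨m≡n; +-monoˡ-≤; +-comm; +-identityʳ; +-suc; m+1+n≰m; m+n≤o⇒m≤o)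
open import Data.Product using (_×_; _,_; proj₁; proj₂; map₂; ∃-syntax)
open import Data.Sum using (_⊎_; inj₁; inj₂; map)
open import Relation.Binary.PropositionalEquality using (_≡_; refl; sym; cong; subst)
open import Relation.Nullary using (contradiction)

module _ (X : Digraph) where
  open Digraph X

  splitAt : ∀ {x a n v} (p : Path X x a n) → PassesThrough X p v →
            ∃[ i ] ∃[ j ] (Path X x v i × Path X v a j × i + j ≡ n)
  splitAt (e ∷ p) start     = 0 , _ , [] , e ∷ p , refl
  splitAt []      end       = 0 , 0 , [] , [] , refl
  splitAt (e ∷ p) (later t) with splitAt p t
  ... | i , j , q , r , i+j≡n = suc i , j , e ∷ q , r , cong suc i+j≡n

  path≡0⇒≡ : ∀ {v a j} → Path X v a j → j ≡ 0 → v ≡ a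
  path≡0⇒≡ [] refl = refl

  path≤1⇒edge : ∀ {v a j} → Path X v a j → j ≤ 1 → v ⇒ a
  path≤1⇒edge {v} []       _ = ⇒-refl v
  path≤1⇒edge (e ∷ [])     _ = e
  path≤1⇒edge (e ∷ (_ ∷ _)) (s≤s ())

module _ (X : Digraph) (A : Digraph.V X → Set) (π : XA-V X A → A-V X A)
         (isProj : IsProjectingDecomposition X A π) where

  πV : (x : Digraph.V X) → ReachesA X A x → Digraph.V X
  πV x r = proj₁ (π (x , r))

  detourVia-π : ∀ {x a m} (r : ReachesA X A x) → A a → Path X x a m →
                ∃[ i ] ∃[ j ] (Path X x (πV x r) i × Path X (πV x r) a j × i + j ≤ m)
  detourVia-π {x} {a} {m} r Aa p with isProj x r a Aa (m , p)
  ... | n , q , q-min , through with splitAt X q through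
  ...   | i , j , u , w , i+j≡n = i , j , u , w , subst (_≤ m) (sym i+j≡n) (q-min m p)

≤-sandwich : ∀ {m n} j → n ≤ m → m + j ≤ suc n →
             (m ≡ n × j ≤ 1) ⊎ (m ≡ suc n × j ≡ 0)
≤-sandwich {m} {n} zero n≤m m+0≤1+n with m≤n⇒m<n∨m≡n (subst (_≤ suc n) (+-identityʳ m) m+0≤1+n)
... | inj₁ m<1+n = inj₁ (≤-antisym (s≤s⁻¹ m<1+n) n≤m , z≤n)
... | inj₂ m≡1+n = inj₂ (m≡1+n , refl)
≤-sandwich {m} {n} 1 n≤m m+1≤1+n =
  inj₁ (≤-antisym (s≤s⁻¹ (subst (_≤ suc n) (+-comm m 1) m+1≤1+n)) n≤m , ≤-refl)
≤-sandwich {m} {n} (suc (suc k)) n≤m m+2+k≤1+n =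
  contradiction (≤-trans (+-monoˡ-≤ (suc (suc k)) n≤m) m+2+k≤1+n)
    (subst (_≰ suc n) (sym (+-suc n (suc k))) (m+1+n≰m (suc n)))

lemma2p7 : (X : Digraph) (A : Digraph.V X → Set)
    (π : XA-V X A → A-V X A) → IsProjectingDecomposition X A π →
    (x y : Digraph.V X) (rx : ReachesA X A x) (ry : ReachesA X A y) →
    Digraph._⇒_ X x y →
    (hx hy : ℕ) → IsHeight X A x hx → IsHeight X A y hy → hx ≥ hy →
    (hx ≡ hy × Digraph._⇒_ X (proj₁ (π (x , rx))) (proj₁ (π (y , ry))))
    ⊎ (hx ≡ suc hy × proj₁ (π (x , rx)) ≡ proj₁ (π (y , ry)))
lemma2p7 X A π isProj x y rx ry x⇒y hx hy (_ , hx-minimal) ((a , Aa , y⇝a) , _) hy≤hx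
  with detourVia-π X A π isProj ry Aa y⇝a
... | i , _ , y⇝πy , _ , i+j≤hy
  with detourVia-π X A π isProj rx (proj₂ (π (y , ry))) (x⇒y ∷ y⇝πy)
... | i′ , j′ , x⇝πx , πx⇝πy , i′+j′≤1+i =
  map (map₂ (path≤1⇒edge X πx⇝πy)) (map₂ (path≡0⇒≡ X πx⇝πy)) (≤-sandwich j′ hy≤hx hx+j′≤1+hy)
  where
  hx+j′≤1+hy : hx + j′ ≤ suc hy
  hx+j′≤1+hy = ≤-trans (+-monoˡ-≤ j′ (hx-minimal _ i′ (proj₂ (π (x , rx))) x⇝πx))
                       (≤-trans i′+j′≤1+i (s≤s (m+n≤o⇒m≤o i i+j≤hy)))
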